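{- Let $G$ be a connected simple graph with $V(G)=\{1,\dots,n\}$ and $E(G)=\{e_1,\dots,e_m\}$. Let $r_i$ ($i=1,\dots,n$), $s_j$ ($j=1,\dots,m$), and $a_e\le b_e$, $c_e\le d_e$ ($e\in E(G)$) be integers. Then there exist integers $a_e\le x_e\le b_e$, $c_e\le y_e\le d_e$ ($e\in E(G)$) such that $$\sum_{i=1}^n r_if_i+\sum_{j=1}^m s_jg_j=\sum_{e\in E(G)}x_ez(e)+\sum_{e\in E(G)}y_ez'(e)$$ if and only if the following hold: (1) if $(t_1,\dots,t_n)^T=N_0(s_1,\dots,s_m)^T+(r_1,\dots,r_n)^T$, then each $t_i$ is even and $\sum_{i=1}^n t_i=0$; (2) for all sets $\emptyset\ne I\subsetneq\{1,\dots,n\}$ and $J\subset E(I)$ such that the induced subgraphs of $G$ on $I$ and on $\{1,\dots,n\}\setminus I$ are connected, $$\sum_{i\in I}r_i+\sum_{e_k\in E(I)\setminus J}s_k-\sum_{e_k\in J}s_k\le 2\!\!\sum_{e=ij\notin J,\ i<j,\ i\in I,\ j\notin I}\!\! b_e-2\!\!\sum_{e=ij\in J,\ i<j,\ i\notin I,\ j\in I}\!\! a_e+2\!\!\sum_{e=ij\notin J,\ i<j,\ i\notin I,\ j\in I}\!\! d_e-2\!\!\sum_{e=ij\in J,\ i<j,\ i\in I,\ j\notin I}\!\! c_e;$$ (3) for all edges $e=e_k\in E(G)$ such that $G-e_k$ is connected, $a_e+c_e\le s_k\le b_e+d_e$.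
   Context: $f_1,\dots,f_n,g_1,\dots,g_m$ is the standard basis of $\mathbb{Z}^n\oplus\mathbb{Z}^m$. For each edge $e=e_k=ij$ with $i<j$, $z(e)=f_i-f_j+g_k$ and $z'(e)=-f_i+f_j+g_k$. For $I\subset\{1,\dots,n\}$, $E(I)$ is the set of edges with exactly one end in $I$. $N_0$ is the $n\times m$ directed incidence matrix of the orientation $D_0$ of $G$ in which each edge $ij$ is oriented with the smaller of $i,j$ as tail: $(N_0)_{ik}=1$ if $i$ is the tail of $e_k$, $-1$ if $i$ is its head, $0$ otherwise. -}

module Defs where

open import Data.Nat using (ℕ; zero; suc)
import Data.Nat as ℕ
import Data.Integer as ℤ
open import Data.Integer using (ℤ; _+_; _*_; -_; 0ℤ; 1ℤ; -1ℤ)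
open import Data.Fin using (Fin; zero; suc; toℕ; _≟_)
open import Data.Bool using (Bool; true; false; if_then_else_; _∧_; not; _xor_)
open import Relation.Nullary.Decidable using (⌊_⌋)
open import Relation.Binary.PropositionalEquality using (_≡_)

Σ[_] : ∀ {n} → (Fin n → ℤ) → ℤ
Σ[_] {zero} f = 0ℤ
Σ[_] {suc n} f = f zero + Σ[_] (λ i → f (suc i))

-- A simple graph on vertices Fin n (= {1,…,n}) with edges e_k (k : Fin m);
-- edge k is {tl k , hd k} with tl k < hd k (so tl is the smaller endpoint,
-- i.e. the tail in the orientation D₀).
record SimpleGraph (n m : ℕ) : Set where
  field
    tl hd  : Fin m → Fin n
    tl<hd  : ∀ k → toℕ (tl k) ℕ.< toℕ (hd k)
    simple : ∀ k k' → tl k ≡ tl k' → hd k ≡ hd k' → k ≡ k'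

module _ {n m : ℕ} (G : SimpleGraph n m) where
  open SimpleGraph G

  data Reach (ok : Fin m → Bool) (S : Fin n → Bool) : Fin n → Fin n → Set where
    here : ∀ {u} → Reach ok S u u
    fwd  : ∀ {u} k → ok k ≡ true → S (hd k) ≡ true →
           Reach ok S u (tl k) → Reach ok S u (hd k)
    bwd  : ∀ {u} k → ok k ≡ true → S (tl k) ≡ true →
           Reach ok S u (hd k) → Reach ok S u (tl k)

  allE : Fin m → Bool
  allE _ = true

  allV : Fin n → Bool
  allV _ = true

  ConnectedOn : (Fin m → Bool) → (Fin n → Bool) → Set
  ConnectedOn ok S = ∀ u v → S u ≡ true → S v ≡ true → Reach ok S u v

  Connected : Set
  Connected = ConnectedOn allE allV

  InducedConnected : (Fin n → Bool) → Set
  InducedConnected S = ConnectedOn allE S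

  DeleteConnected : Fin m → Set
  DeleteConnected k = ConnectedOn (λ k' → not ⌊ k' ≟ k ⌋) allV

  N₀ : Fin n → Fin m → ℤ
  N₀ i k = if ⌊ i ≟ tl k ⌋ then 1ℤ else (if ⌊ i ≟ hd k ⌋ then -1ℤ else 0ℤ)

  -- f-part and g-part of z(e_k) and z'(e_k)
  zf : Fin m → Fin n → ℤ
  zf k i = N₀ i k

  z'f : Fin m → Fin n → ℤ
  z'f k i = - N₀ i k

  zg : Fin m → Fin m → ℤ
  zg k j = if ⌊ j ≟ k ⌋ then 1ℤ else 0ℤ

  z'g : Fin m → Fin m → ℤ
  z'g = zg

  EI : (Fin n → Bool) → Fin m → Bool
  EI I k = I (tl k) xor I (hd k)

  lhs2 : (r : Fin n → ℤ) (s : Fin m → ℤ) (I : Fin n → Bool) (J : Fin m → Bool) → ℤ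
  lhs2 r s I J =
    Σ[ (λ i → if I i then r i else 0ℤ) ]
    + Σ[ (λ k → if EI I k ∧ not (J k) then s k else 0ℤ) ]
    + - Σ[ (λ k → if J k then s k else 0ℤ) ]

  rhs2 : (a b c d : Fin m → ℤ) (I : Fin n → Bool) (J : Fin m → Bool) → ℤ
  rhs2 a b c d I J =
      2ℤ * Σ[ (λ k → if not (J k) ∧ I (tl k) ∧ not (I (hd k)) then b k else 0ℤ) ]
    + - (2ℤ * Σ[ (λ k → if J k ∧ not (I (tl k)) ∧ I (hd k) then a k else 0ℤ) ])
    + 2ℤ * Σ[ (λ k → if not (J k) ∧ not (I (tl k)) ∧ I (hd k) then d k else 0ℤ) ]
    + - (2ℤ * Σ[ (λ k → if J k ∧ I (tl k) ∧ not (I (hd k)) then c k else 0ℤ) ])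
    where
      2ℤ : ℤ
      2ℤ = ℤ.+ 2

module Submission where

-- The g-coordinates say s = x + y, so y = s - x is determined by x, and the
-- f-coordinates then say r = N₀ (x - y), i.e. N₀ x = Q with Q = (N₀ s + r)/2:
-- x is an integral flow on the orientation D₀ with divergence Q and bounds
-- lo = max(a, s - d) ≤ x ≤ up = min(b, s - c).  The theorem is therefore a
-- reformulation of Hoffman's circulation theorem, developed in this order:
--
-- Necessity is a direct computation; sufficiency feeds Q, lo, up into
-- Hoffman's theorem, using (1) for Q, (2) for the cut condition and (3) for
-- lo ≤ up away from bridges.

open import Defs

open import Data.Nat using (ℕ; zero; suc)
import Data.Nat as ℕ
import Data.Nat.Properties as ℕP
open import Data.Integer
  using (ℤ; _+_; _*_; _-_; -_; _≤_; _⊓_; 0ℤ; 1ℤ; -1ℤ; +_)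
open import Data.Integer.Properties hiding (_≟_)
open import Data.Integer.Divisibility using (_∣_; *-monoʳ-∣)
import Data.Integer.Divisibility.Signed as Signed
import Data.Nat.Divisibility as ℕD
open import Data.Integer.Tactic.RingSolver using (solve-∀)
open import Data.Fin using (Fin; zero; suc; _≟_; toℕ)
open import Data.Fin.Properties using (suc-injective)
open import Data.Bool using (Bool; true; false; not; _∧_; _∨_; _xor_; if_then_else_)
open import Data.Bool.Properties using (∨-zeroʳ; ∧-zeroʳ)
open import Data.Product using (Σ; ∃; _×_; _,_; proj₁; proj₂)
open import Data.Sum using (_⊎_; inj₁; inj₂)
open import Data.Empty using (⊥; ⊥-elim)
open import Relation.Nullary using (yes; no)
open import Relation.Nullary.Decidable using (⌊_⌋)
open import Relation.Binary.PropositionalEquality hiding (J)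
open import Function.Bundles using (_⇔_; mk⇔)

Σ-cong : ∀ {n} {f g : Fin n → ℤ} → (∀ i → f i ≡ g i) → Σ[ f ] ≡ Σ[ g ]
Σ-cong {zero}  h = refl
Σ-cong {suc n} h = cong₂ _+_ (h zero) (Σ-cong (λ i → h (suc i)))

Σ-vanish : ∀ {n} {f : Fin n → ℤ} → (∀ i → f i ≡ 0ℤ) → Σ[ f ] ≡ 0ℤ
Σ-vanish {zero}  h = refl
Σ-vanish {suc n} h = cong₂ _+_ (h zero) (Σ-vanish (λ i → h (suc i)))

Σ-+ : ∀ {n} (f g : Fin n → ℤ) → Σ[ (λ i → f i + g i) ] ≡ Σ[ f ] + Σ[ g ]
Σ-+ {zero}  f g = refl
Σ-+ {suc n} f g =
  trans (cong (_+_ (f zero + g zero)) (Σ-+ (λ i → f (suc i)) (λ i → g (suc i))))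
        (interchange (f zero) (g zero) _ _)
  where
  interchange : ∀ a b c d → (a + b) + (c + d) ≡ (a + c) + (b + d)
  interchange = solve-∀

Σ-neg : ∀ {n} (f : Fin n → ℤ) → Σ[ (λ i → - f i) ] ≡ - Σ[ f ]
Σ-neg {zero}  f = refl
Σ-neg {suc n} f = trans (cong (_+_ (- f zero)) (Σ-neg (λ i → f (suc i))))
                        (sym (neg-distrib-+ (f zero) _))

Σ-* : ∀ {n} (c : ℤ) (f : Fin n → ℤ) → Σ[ (λ i → c * f i) ] ≡ c * Σ[ f ]
Σ-* {zero}  c f = sym (*-zeroʳ c)
Σ-* {suc n} c f = trans (cong (_+_ (c * f zero)) (Σ-* c (λ i → f (suc i))))
                        (sym (*-distribˡ-+ c (f zero) _))

Σ-mono : ∀ {n} {f g : Fin n → ℤ} → (∀ i → f i ≤ g i) → Σ[ f ] ≤ Σ[ g ]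
Σ-mono {zero}  h = ≤-refl
Σ-mono {suc n} h = +-mono-≤ (h zero) (Σ-mono (λ i → h (suc i)))

Σ-swap : ∀ {n m} (F : Fin n → Fin m → ℤ) →
  Σ[ (λ i → Σ[ F i ]) ] ≡ Σ[ (λ k → Σ[ (λ i → F i k) ]) ]
Σ-swap {zero} {m} F = sym (Σ-vanish {m} (λ _ → refl))
Σ-swap {suc n} F = trans (cong (_+_ Σ[ F zero ]) (Σ-swap (λ i → F (suc i))))
                         (sym (Σ-+ (F zero) _))

Σ-single : ∀ {n} (f : Fin n → ℤ) (p : Fin n) → (∀ i → i ≢ p → f i ≡ 0ℤ) → Σ[ f ] ≡ f p
Σ-single {suc n} f zero h =
  trans (cong (_+_ (f zero)) (Σ-vanish (λ i → h (suc i) (λ ())))) (+-identityʳ _)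
Σ-single {suc n} f (suc p) h =
  trans (cong (_+ Σ[ (λ i → f (suc i)) ]) (h zero (λ ())))
        (trans (+-identityˡ _)
               (Σ-single (λ i → f (suc i)) p (λ i i≢p → h (suc i) (λ e → i≢p (suc-injective e)))))

≟-refl : ∀ {n} (p : Fin n) → ⌊ p ≟ p ⌋ ≡ true
≟-refl p with p ≟ p
... | yes _ = refl
... | no p≢p = ⊥-elim (p≢p refl)

≟-≢ : ∀ {n} {i p : Fin n} → i ≢ p → ⌊ i ≟ p ⌋ ≡ false
≟-≢ {i = i} {p} i≢p with i ≟ p
... | yes i≡p = ⊥-elim (i≢p i≡p)
... | no _ = refl

≟-sound : ∀ {n} {i j : Fin n} → ⌊ i ≟ j ⌋ ≡ true → i ≡ j
≟-sound {i = i} {j} e with i ≟ j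
... | yes i≡j = i≡j

Σ-δ : ∀ {n} (p : Fin n) (f : Fin n → ℤ) → Σ[ (λ i → if ⌊ i ≟ p ⌋ then f i else 0ℤ) ] ≡ f p
Σ-δ p f = trans (Σ-single _ p (λ i i≢p → cong (λ b → if b then f i else 0ℤ) (≟-≢ i≢p)))
                (cong (λ b → if b then f p else 0ℤ) (≟-refl p))

restrict : ∀ {n} → (Fin n → ℤ) → (Fin n → Bool) → Fin n → ℤ
restrict D I i = if I i then D i else 0ℤ

ΣOn : ∀ {n} → (Fin n → ℤ) → (Fin n → Bool) → ℤ
ΣOn D I = Σ[ restrict D I ]

ΣOn-cong-set : ∀ {n} (D : Fin n → ℤ) {I J : Fin n → Bool} → (∀ i → I i ≡ J i) → ΣOn D I ≡ ΣOn D J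
ΣOn-cong-set D h = Σ-cong (λ i → cong (λ b → if b then D i else 0ℤ) (h i))

ΣOn-cong-fun : ∀ {n} {D E : Fin n → ℤ} (I : Fin n → Bool) → (∀ i → D i ≡ E i) → ΣOn D I ≡ ΣOn E I
ΣOn-cong-fun I h = Σ-cong (λ i → cong (λ z → if I i then z else 0ℤ) (h i))

ΣOn-+ : ∀ {n} (D E : Fin n → ℤ) I → ΣOn (λ i → D i + E i) I ≡ ΣOn D I + ΣOn E I
ΣOn-+ D E I = trans (Σ-cong pointwise) (Σ-+ (restrict D I) (restrict E I))
  where
  pointwise : ∀ i → (if I i then D i + E i else 0ℤ) ≡ (if I i then D i else 0ℤ) + (if I i then E i else 0ℤ)
  pointwise i with I i
  ... | true  = refl
  ... | false = refl

ΣOn-* : ∀ {n} (c : ℤ) (D : Fin n → ℤ) I → ΣOn (λ i → c * D i) I ≡ c * ΣOn D I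
ΣOn-* c D I = trans (Σ-cong pointwise) (Σ-* c (restrict D I))
  where
  pointwise : ∀ i → (if I i then c * D i else 0ℤ) ≡ c * (if I i then D i else 0ℤ)
  pointwise i with I i
  ... | true  = refl
  ... | false = sym (*-zeroʳ c)

ΣOn-empty : ∀ {n} (D : Fin n → ℤ) I → (∀ i → I i ≡ false) → ΣOn D I ≡ 0ℤ
ΣOn-empty D I h = Σ-vanish (λ i → cong (λ b → if b then D i else 0ℤ) (h i))

ΣOn-full : ∀ {n} (D : Fin n → ℤ) I → (∀ i → I i ≡ true) → ΣOn D I ≡ Σ[ D ]
ΣOn-full D I h = Σ-cong (λ i → cong (λ b → if b then D i else 0ℤ) (h i))

ΣOn-compl : ∀ {n} (D : Fin n → ℤ) I → ΣOn D I + ΣOn D (λ i → not (I i)) ≡ Σ[ D ]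
ΣOn-compl D I = trans (sym (Σ-+ (restrict D I) (restrict D _))) (Σ-cong pointwise)
  where
  pointwise : ∀ i → (if I i then D i else 0ℤ) + (if not (I i) then D i else 0ℤ) ≡ D i
  pointwise i with I i
  ... | true  = +-identityʳ _
  ... | false = +-identityˡ _

ΣOn-modular : ∀ {n} (D : Fin n → ℤ) I J →
  ΣOn D (λ i → I i ∨ J i) + ΣOn D (λ i → I i ∧ J i) ≡ ΣOn D I + ΣOn D J
ΣOn-modular D I J =
  trans (sym (Σ-+ (restrict D _) (restrict D _))) (trans (Σ-cong pointwise) (Σ-+ (restrict D I) (restrict D J)))
  where
  pointwise : ∀ i → (if I i ∨ J i then D i else 0ℤ) + (if I i ∧ J i then D i else 0ℤ)
                  ≡ (if I i then D i else 0ℤ) + (if J i then D i else 0ℤ)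
  pointwise i with I i | J i
  ... | true  | true  = refl
  ... | true  | false = refl
  ... | false | true  = +-comm (D i) 0ℤ
  ... | false | false = refl

ΣOn-singleton : ∀ {n} (D : Fin n → ℤ) i → ΣOn D (λ j → ⌊ j ≟ i ⌋) ≡ D i
ΣOn-singleton D i = Σ-δ i D

≤-shift : ∀ {a b a' b' : ℤ} (t : ℤ) → a ≤ b → a' ≡ a + t → b' ≡ b + t → a' ≤ b'
≤-shift t a≤b e₁ e₂ = subst₂ _≤_ (sym e₁) (sym e₂) (+-monoˡ-≤ t a≤b)

≤-move-sub : ∀ {a b c : ℤ} → a ≤ b + c → a - c ≤ b
≤-move-sub {a} {b} {c} p = ≤-shift (- c) p refl (e b c)
  where
  e : ∀ b c → b ≡ (b + c) - c
  e = solve-∀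

≤-move-add : ∀ {a b c : ℤ} → a + c ≤ b → a ≤ b - c
≤-move-add {a} {b} {c} p = ≤-shift (- c) p (e a c) refl
  where
  e : ∀ a c → a ≡ (a + c) - c
  e = solve-∀

≤-unmove-sub : ∀ {a b c : ℤ} → a ≤ b - c → a + c ≤ b
≤-unmove-sub {a} {b} {c} p = ≤-shift c p refl (e b c)
  where
  e : ∀ b c → b ≡ (b - c) + c
  e = solve-∀

≤-flip-sub : ∀ {a b c : ℤ} → a ≤ b - c → c ≤ b - a
≤-flip-sub {a} {b} {c} p = ≤-shift (c - a) p (e₁ a c) (e₂ a b c)
  where
  e₁ : ∀ a c → c ≡ a + (c - a)
  e₁ = solve-∀
  e₂ : ∀ a b c → b - a ≡ (b - c) + (c - a)
  e₂ = solve-∀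

≤-flip-sub' : ∀ {a b c : ℤ} → a - b ≤ c → a - c ≤ b
≤-flip-sub' {a} {b} {c} p = ≤-shift (b - c) p (e₁ a b c) (e₂ b c)
  where
  e₁ : ∀ a b c → a - c ≡ (a - b) + (b - c)
  e₁ = solve-∀
  e₂ : ∀ b c → b ≡ c + (b - c)
  e₂ = solve-∀

≤-cross : ∀ {a b c d : ℤ} → a + b ≤ c + d → a - c ≤ d - b
≤-cross {a} {b} {c} {d} p = ≤-shift (- b - c) p (e₁ a b c) (e₂ b c d)
  where
  e₁ : ∀ a b c → a - c ≡ (a + b) + (- b - c)
  e₁ = solve-∀
  e₂ : ∀ b c d → d - b ≡ (c + d) + (- b - c)
  e₂ = solve-∀

ind : Bool → ℤ
ind b = if b then 1ℤ else 0ℤ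

incidence : ∀ {n m} → (tl hd : Fin m → Fin n) → Fin n → Fin m → ℤ
incidence tl hd i k = if ⌊ i ≟ tl k ⌋ then 1ℤ else (if ⌊ i ≟ hd k ⌋ then -1ℤ else 0ℤ)

divergence : ∀ {n m} → (tl hd : Fin m → Fin n) → (Fin m → ℤ) → Fin n → ℤ
divergence tl hd x i = Σ[ (λ k → incidence tl hd i k * x k) ]

incidence-cut : ∀ {n m} (tl hd : Fin m → Fin n) k → tl k ≢ hd k → (I : Fin n → Bool) →
  ΣOn (λ i → incidence tl hd i k) I ≡ ind (I (tl k)) - ind (I (hd k))
incidence-cut tl hd k tl≢hd I = begin
  ΣOn (λ i → incidence tl hd i k) I
    ≡⟨ Σ-cong pointwise ⟩
  Σ[ (λ i → atTail i + - atHead i) ]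
    ≡⟨ trans (Σ-+ atTail (λ i → - atHead i)) (cong (_+_ Σ[ atTail ]) (Σ-neg atHead)) ⟩
  Σ[ atTail ] - Σ[ atHead ]
    ≡⟨ cong₂ _-_ (Σ-δ (tl k) (λ i → ind (I i))) (Σ-δ (hd k) (λ i → ind (I i))) ⟩
  ind (I (tl k)) - ind (I (hd k)) ∎
  where
  open ≡-Reasoning
  atTail atHead : Fin _ → ℤ
  atTail i = if ⌊ i ≟ tl k ⌋ then ind (I i) else 0ℤ
  atHead i = if ⌊ i ≟ hd k ⌋ then ind (I i) else 0ℤ
  pointwise : ∀ i → restrict (λ j → incidence tl hd j k) I i ≡ atTail i + - atHead i
  pointwise i with i ≟ tl k | i ≟ hd k | I i
  ... | yes i≡t | yes i≡h | _     = ⊥-elim (tl≢hd (trans (sym i≡t) i≡h))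
  ... | yes _   | no _    | true  = refl
  ... | yes _   | no _    | false = refl
  ... | no _    | yes _   | true  = refl
  ... | no _    | yes _   | false = refl
  ... | no _    | no _    | true  = refl
  ... | no _    | no _    | false = refl

ΣOn-divergence : ∀ {n m} (tl hd : Fin m → Fin n) → (∀ k → tl k ≢ hd k) → (x : Fin m → ℤ) (I : Fin n → Bool) →
  ΣOn (divergence tl hd x) I ≡ Σ[ (λ k → x k * (ind (I (tl k)) - ind (I (hd k)))) ]
ΣOn-divergence {n} {m} tl hd tl≢hd x I = begin
  ΣOn (divergence tl hd x) I
    ≡⟨ Σ-cong pointwise ⟩
  Σ[ (λ i → Σ[ (λ k → x k * column k i) ]) ]
    ≡⟨ Σ-swap (λ i k → x k * column k i) ⟩
  Σ[ (λ k → Σ[ (λ i → x k * column k i) ]) ]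
    ≡⟨ Σ-cong (λ k → trans (Σ-* (x k) (column k)) (cong (x k *_) (incidence-cut tl hd k (tl≢hd k) I))) ⟩
  Σ[ (λ k → x k * (ind (I (tl k)) - ind (I (hd k)))) ] ∎
  where
  open ≡-Reasoning
  column : Fin m → Fin n → ℤ
  column k = restrict (λ i → incidence tl hd i k) I
  pointwise : ∀ i → restrict (divergence tl hd x) I i ≡ Σ[ (λ k → x k * column k i) ]
  pointwise i with I i
  ... | true  = Σ-cong (λ k → *-comm (incidence tl hd i k) (x k))
  ... | false = sym (Σ-vanish (λ k → *-zeroʳ (x k)))

divergence-total : ∀ {n m} (tl hd : Fin m → Fin n) → (∀ k → tl k ≢ hd k) → (x : Fin m → ℤ) →
  Σ[ divergence tl hd x ] ≡ 0ℤ
divergence-total tl hd tl≢hd x =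
  trans (ΣOn-divergence tl hd tl≢hd x (λ _ → true)) (Σ-vanish (λ k → *-zeroʳ (x k)))

-- The cut capacity of I for arc bounds l ≤ x ≤ u: the largest possible net
-- outflow of I, i.e. u over arcs leaving I minus l over arcs entering I.
arcCap : ℤ → ℤ → Bool → Bool → ℤ
arcCap l u true  true  = 0ℤ
arcCap l u true  false = u
arcCap l u false true  = - l
arcCap l u false false = 0ℤ

arcCapOf : ∀ {n m} → (tl hd : Fin m → Fin n) → (l u : Fin m → ℤ) → (Fin n → Bool) → Fin m → ℤ
arcCapOf tl hd l u I k = arcCap (l k) (u k) (I (tl k)) (I (hd k))

cutCap : ∀ {n m} → (tl hd : Fin m → Fin n) → (l u : Fin m → ℤ) → (Fin n → Bool) → ℤ
cutCap tl hd l u I = Σ[ arcCapOf tl hd l u I ]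

cutCap-cong : ∀ {n m} (tl hd : Fin m → Fin n) (l u : Fin m → ℤ) {I J : Fin n → Bool} →
  (∀ i → I i ≡ J i) → cutCap tl hd l u I ≡ cutCap tl hd l u J
cutCap-cong tl hd l u h = Σ-cong (λ k → cong₂ (arcCap (l k) (u k)) (h (tl k)) (h (hd k)))

arcCap-submodular : ∀ {l u} → l ≤ u → ∀ a₁ b₁ a₂ b₂ →
  arcCap l u (a₁ ∨ a₂) (b₁ ∨ b₂) + arcCap l u (a₁ ∧ a₂) (b₁ ∧ b₂)
    ≤ arcCap l u a₁ b₁ + arcCap l u a₂ b₂
arcCap-submodular l≤u true  true  true  true  = ≤-refl
arcCap-submodular l≤u true  true  true  false = ≤-refl
arcCap-submodular l≤u true  true  false true  = ≤-refl
arcCap-submodular l≤u true  true  false false = ≤-refl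
arcCap-submodular {u = u} l≤u true  false true  true  = ≤-reflexive (+-comm 0ℤ u)
arcCap-submodular l≤u true  false true  false = ≤-refl
arcCap-submodular l≤u true  false false true  = i≤j⇒0≤j-i l≤u
arcCap-submodular l≤u true  false false false = ≤-refl
arcCap-submodular {l} l≤u false true  true  true  = ≤-reflexive (+-comm 0ℤ (- l))
arcCap-submodular {l} {u} l≤u false true  true  false = subst (0ℤ ≤_) (+-comm u (- l)) (i≤j⇒0≤j-i l≤u)
arcCap-submodular l≤u false true  false true  = ≤-refl
arcCap-submodular l≤u false true  false false = ≤-refl
arcCap-submodular l≤u false false true  true  = ≤-refl
arcCap-submodular {u = u} l≤u false false true  false = ≤-reflexive (+-comm u 0ℤ)
arcCap-submodular {l} l≤u false false false true  = ≤-reflexive (+-comm (- l) 0ℤ)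
arcCap-submodular l≤u false false false false = ≤-refl

cutCap-submodular : ∀ {n m} (tl hd : Fin m → Fin n) (l u : Fin m → ℤ) → (∀ k → l k ≤ u k) →
  (I J : Fin n → Bool) →
  cutCap tl hd l u (λ i → I i ∨ J i) + cutCap tl hd l u (λ i → I i ∧ J i)
    ≤ cutCap tl hd l u I + cutCap tl hd l u J
cutCap-submodular tl hd l u l≤u I J =
  subst₂ _≤_ (Σ-+ (arcCapOf tl hd l u (λ i → I i ∨ J i)) (arcCapOf tl hd l u (λ i → I i ∧ J i)))
             (Σ-+ (arcCapOf tl hd l u I) (arcCapOf tl hd l u J))
    (Σ-mono (λ k → arcCap-submodular (l≤u k) (I (tl k)) (I (hd k)) (J (tl k)) (J (hd k))))

CutCondition : ∀ {n m} → (tl hd : Fin m → Fin n) → (l u : Fin m → ℤ) → (Fin n → ℤ) → Set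
CutCondition tl hd l u D = ∀ I → ΣOn D I ≤ cutCap tl hd l u I

extend : ∀ {n} → Bool → (Fin n → Bool) → Fin (suc n) → Bool
extend b I zero    = b
extend b I (suc i) = I i

minOver : ∀ {n} → ((Fin n → Bool) → ℤ) → ℤ
minOver {zero}  F = F (λ ())
minOver {suc n} F = minOver (λ I → F (extend false I)) ⊓ minOver (λ I → F (extend true I))

minOver-glb : ∀ {n} (F : (Fin n → Bool) → ℤ) {c : ℤ} → (∀ I → c ≤ F I) → c ≤ minOver F
minOver-glb {zero}  F h = h _
minOver-glb {suc n} F h = ⊓-glb (minOver-glb (λ I → F (extend false I)) (λ I → h _))
                                (minOver-glb (λ I → F (extend true I)) (λ I → h _))

-- F respects pointwise equality of subsets (needed as there is no funext).
Extensional : ∀ {n} → ((Fin n → Bool) → ℤ) → Set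
Extensional F = ∀ I J → (∀ i → I i ≡ J i) → F I ≡ F J

minOver-≤ : ∀ {n} (F : (Fin n → Bool) → ℤ) → Extensional F → ∀ I → minOver F ≤ F I
minOver-≤ {zero}  F ext I = ≤-reflexive (ext _ _ (λ ()))
minOver-≤ {suc n} F ext I = byFirst (I zero) refl
  where
  branch : ∀ b → I zero ≡ b → minOver (λ J → F (extend b J)) ≤ F I
  branch b I₀≡b = ≤-trans
    (minOver-≤ (λ J → F (extend b J)) (λ J J' h → ext _ _ (λ { zero → refl ; (suc i) → h i }))
               (λ i → I (suc i)))
    (≤-reflexive (ext _ _ (λ { zero → sym I₀≡b ; (suc i) → refl })))
  byFirst : ∀ b → I zero ≡ b → minOver F ≤ F I
  byFirst false I₀ = ≤-trans (i⊓j≤i _ _) (branch false I₀)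
  byFirst true  I₀ = ≤-trans (i⊓j≤j _ _) (branch true I₀)

-- Given the cut condition for the
-- arcs 0, 1, …, m, we fix the flow x₀ on arc 0 (from p to q) so that the
-- residual demand D - x₀ · (column 0 of the incidence matrix) satisfies the
-- cut condition for the remaining arcs.  Arc 0 forces
--   x₀ ≥ D(I) - rest(I)   for cuts I that arc 0 leaves,
--   x₀ ≤ rest(J) - D(J)   for cuts J that arc 0 enters,
-- and these bounds are compatible with each other (by submodularity) and
-- with l₀ ≤ x₀ ≤ u₀ (by the cut condition itself).
module FixFirstArc {n m : ℕ} (tl hd : Fin (suc m) → Fin n) (l u : Fin (suc m) → ℤ)
  (l≤u : ∀ k → l k ≤ u k) (D : Fin n → ℤ) (cut : CutCondition tl hd l u D) where

  p q : Fin n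
  p = tl zero
  q = hd zero

  tl' hd' : Fin m → Fin n
  tl' k = tl (suc k)
  hd' k = hd (suc k)

  l' u' : Fin m → ℤ
  l' k = l (suc k)
  u' k = u (suc k)

  rest : (Fin n → Bool) → ℤ
  rest = cutCap tl' hd' l' u'

  cutAt : ∀ I {bp bq} → I p ≡ bp → I q ≡ bq → ΣOn D I ≤ arcCap (l zero) (u zero) bp bq + rest I
  cutAt I Ip Iq = subst (λ z → ΣOn D I ≤ z + rest I) (cong₂ (arcCap (l zero) (u zero)) Ip Iq) (cut I)

  entryBound : (Fin n → Bool) → ℤ
  entryBound I = if I q ∧ not (I p) then rest I - ΣOn D I else u zero

  entryBound-ext : Extensional entryBound
  entryBound-ext I J h = cong₂ (λ b z → if b then z else u zero)
    (cong₂ (λ a b → a ∧ not b) (h q) (h p))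
    (cong₂ _-_ (cutCap-cong tl' hd' l' u' h) (ΣOn-cong-set D h))

  x₀ : ℤ
  x₀ = u zero ⊓ minOver entryBound

  x₀≤u : x₀ ≤ u zero
  x₀≤u = i⊓j≤i _ _

  l≤entryBound : ∀ I → l zero ≤ entryBound I
  l≤entryBound I with I q in Iq | I p in Ip
  ... | true  | true  = l≤u zero
  ... | true  | false =
    ≤-flip-sub {ΣOn D I} {rest I} {l zero} (subst (ΣOn D I ≤_) (+-comm (- l zero) (rest I)) (cutAt I Ip Iq))
  ... | false | _     = l≤u zero

  l≤x₀ : l zero ≤ x₀
  l≤x₀ = ⊓-glb (l≤u zero) (minOver-glb entryBound l≤entryBound)

  x₀-entering : ∀ J → J p ≡ false → J q ≡ true → x₀ ≤ rest J - ΣOn D J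
  x₀-entering J Jp Jq = ≤-trans (i⊓j≤j _ _) (≤-trans (minOver-≤ entryBound entryBound-ext J)
    (≤-reflexive (cong (λ b → if b then rest J - ΣOn D J else u zero) (cong₂ (λ a b → a ∧ not b) Jq Jp))))

  -- Submodularity: the bound from a leaving cut never exceeds the bound
  -- from an entering cut.
  leaving≤entering : ∀ I J → I p ≡ true → I q ≡ false → J p ≡ false → J q ≡ true →
    ΣOn D I - rest I ≤ rest J - ΣOn D J
  leaving≤entering I J Ip Iq Jp Jq = ≤-cross {ΣOn D I} {ΣOn D J} {rest I} {rest J}
    (subst (_≤ rest I + rest J) (ΣOn-modular D I J)
      (≤-trans (+-mono-≤ onUnion onIntersection) (cutCap-submodular tl' hd' l' u' (λ k → l≤u (suc k)) I J)))
    where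
    -- Arc 0 lies inside I ∪ J and outside I ∩ J.
    onUnion : ΣOn D (λ i → I i ∨ J i) ≤ rest (λ i → I i ∨ J i)
    onUnion = subst (ΣOn D _ ≤_) (+-identityˡ _)
      (cutAt (λ i → I i ∨ J i) (cong (_∨ J p) Ip) (trans (cong (I q ∨_) Jq) (∨-zeroʳ (I q))))
    onIntersection : ΣOn D (λ i → I i ∧ J i) ≤ rest (λ i → I i ∧ J i)
    onIntersection = subst (ΣOn D _ ≤_) (+-identityˡ _)
      (cutAt (λ i → I i ∧ J i) (trans (cong (I p ∧_) Jp) (∧-zeroʳ (I p))) (cong (_∧ J q) Iq))

  x₀-leaving : ∀ I → I p ≡ true → I q ≡ false → ΣOn D I - rest I ≤ x₀
  x₀-leaving I Ip Iq = ⊓-glb belowU (minOver-glb entryBound belowEntry)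
    where
    belowU : ΣOn D I - rest I ≤ u zero
    belowU = ≤-move-sub {ΣOn D I} {u zero} {rest I} (cutAt I Ip Iq)
    belowEntry : ∀ J → ΣOn D I - rest I ≤ entryBound J
    belowEntry J with J q in Jq | J p in Jp
    ... | true  | true  = belowU
    ... | true  | false = leaving≤entering I J Ip Iq Jp Jq
    ... | false | _     = belowU

  D' : Fin n → ℤ
  D' i = D i - x₀ * incidence tl hd i zero

  residual-cut : tl zero ≢ hd zero → ∀ I → ΣOn D' I ≡ ΣOn D I - x₀ * (ind (I p) - ind (I q))
  residual-cut p≢q I = begin
    ΣOn D' I
      ≡⟨ ΣOn-+ D (λ i → - (x₀ * incidence tl hd i zero)) I ⟩
    ΣOn D I + ΣOn (λ i → - (x₀ * incidence tl hd i zero)) I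
      ≡⟨ cong (_+_ (ΣOn D I)) (ΣOn-cong-fun I (λ i → neg-distribˡ-* x₀ _)) ⟩
    ΣOn D I + ΣOn (λ i → - x₀ * incidence tl hd i zero) I
      ≡⟨ cong (_+_ (ΣOn D I)) (ΣOn-* (- x₀) (λ i → incidence tl hd i zero) I) ⟩
    ΣOn D I + - x₀ * ΣOn (λ i → incidence tl hd i zero) I
      ≡⟨ cong (λ z → ΣOn D I + - x₀ * z) (incidence-cut tl hd zero p≢q I) ⟩
    ΣOn D I + - x₀ * (ind (I p) - ind (I q))
      ≡⟨ cong (_+_ (ΣOn D I)) (sym (neg-distribˡ-* x₀ _)) ⟩
    ΣOn D I - x₀ * (ind (I p) - ind (I q)) ∎
    where open ≡-Reasoning

  residual-condition : tl zero ≢ hd zero → CutCondition tl' hd' l' u' D'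
  residual-condition p≢q I = subst (_≤ rest I) (sym (residual-cut p≢q I)) (byEnds (I p) (I q) refl refl)
    where
    noChange : ∀ a x → a - x * 0ℤ ≡ a
    noChange = solve-∀
    sendOut : ∀ a x → a - x * 1ℤ ≡ a - x
    sendOut = solve-∀
    sendIn : ∀ a x → a - x * - 1ℤ ≡ a + x
    sendIn = solve-∀
    byEnds : ∀ bp bq → I p ≡ bp → I q ≡ bq → ΣOn D I - x₀ * (ind bp - ind bq) ≤ rest I
    byEnds true  true  Ip Iq = subst₂ _≤_ (sym (noChange (ΣOn D I) x₀)) (+-identityˡ (rest I)) (cutAt I Ip Iq)
    byEnds false false Ip Iq = subst₂ _≤_ (sym (noChange (ΣOn D I) x₀)) (+-identityˡ (rest I)) (cutAt I Ip Iq)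
    byEnds true  false Ip Iq = subst (_≤ rest I) (sym (sendOut (ΣOn D I) x₀))
      (≤-flip-sub' {ΣOn D I} {rest I} {x₀} (x₀-leaving I Ip Iq))
    byEnds false true  Ip Iq = subst (_≤ rest I) (sym (sendIn (ΣOn D I) x₀))
      (≤-unmove-sub (≤-flip-sub {x₀} {rest I} {ΣOn D I} (x₀-entering I Ip Iq)))

  residual-total : tl zero ≢ hd zero → Σ[ D ] ≡ 0ℤ → Σ[ D' ] ≡ 0ℤ
  residual-total p≢q ΣD≡0 = trans (residual-cut p≢q (λ _ → true))
    (cong₂ _-_ ΣD≡0 (*-zeroʳ x₀))

hoffman : ∀ {n} m (tl hd : Fin m → Fin n) → (∀ k → tl k ≢ hd k) → (l u : Fin m → ℤ) →
  (∀ k → l k ≤ u k) → (D : Fin n → ℤ) → Σ[ D ] ≡ 0ℤ → CutCondition tl hd l u D →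
  Σ (Fin m → ℤ) (λ x → (∀ k → l k ≤ x k × x k ≤ u k) × (∀ i → D i ≡ divergence tl hd x i))
hoffman zero tl hd _ l u _ D ΣD≡0 cut = (λ ()) , (λ ()) , λ i → ≤-antisym (atMost i) (atLeast i)
  where
  atMost : ∀ i → D i ≤ 0ℤ
  atMost i = subst (_≤ 0ℤ) (ΣOn-singleton D i) (cut (λ j → ⌊ j ≟ i ⌋))
  atLeast : ∀ i → 0ℤ ≤ D i
  atLeast i = ≤-shift (D i) (cut (λ j → not ⌊ j ≟ i ⌋))
    (sym (trans (+-comm _ (D i)) (trans (cong (_+ ΣOn D (λ j → not ⌊ j ≟ i ⌋)) (sym (ΣOn-singleton D i)))
                                        (trans (ΣOn-compl D (λ j → ⌊ j ≟ i ⌋)) ΣD≡0))))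
    (sym (+-identityˡ (D i)))
hoffman (suc m) tl hd tl≢hd l u l≤u D ΣD≡0 cut =
  (λ { zero → x₀ ; (suc k) → proj₁ rec k }) ,
  (λ { zero → l≤x₀ , x₀≤u ; (suc k) → proj₁ (proj₂ rec) k }) ,
  λ i → sym (trans (cong (_+_ (incidence tl hd i zero * x₀)) (sym (proj₂ (proj₂ rec) i)))
                   (restore (D i) x₀ (incidence tl hd i zero)))
  where
  open FixFirstArc tl hd l u l≤u D cut
  rec = hoffman m tl' hd' (λ k → tl≢hd (suc k)) l' u' (λ k → l≤u (suc k)) D'
                (residual-total (tl≢hd zero) ΣD≡0) (residual-condition (tl≢hd zero))
  restore : ∀ d x c → c * x + (d - x * c) ≡ d
  restore = solve-∀

true≢false : true ≢ false
true≢false ()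

∧-true : ∀ {a b} → a ∧ b ≡ true → a ≡ true × b ≡ true
∧-true {true} {true} _ = refl , refl

∨-true : ∀ {a b} → a ∨ b ≡ true → a ≡ true ⊎ b ≡ true
∨-true {true}  _ = inj₁ refl
∨-true {false} e = inj₂ e

not-true : ∀ {b} → not b ≡ true → b ≡ false
not-true {false} _ = refl

not-false : ∀ {b} → not b ≡ false → b ≡ true
not-false {true} _ = refl

search : ∀ {m} (f : Fin m → Bool) → (∃ λ k → f k ≡ true) ⊎ (∀ k → f k ≡ false)
search {zero}  f = inj₂ (λ ())
search {suc m} f with f zero in f₀ | search (λ k → f (suc k))
... | true  | _                = inj₁ (zero , f₀)
... | false | inj₁ (k , fk)    = inj₁ (suc k , fk)
... | false | inj₂ allFalse    = inj₂ (λ { zero → f₀ ; (suc k) → allFalse k })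

anyB : ∀ {m} → (Fin m → Bool) → Bool
anyB {zero}  f = false
anyB {suc m} f = f zero ∨ anyB (λ k → f (suc k))

anyB-sound : ∀ {m} (f : Fin m → Bool) → anyB f ≡ true → ∃ λ k → f k ≡ true
anyB-sound {suc m} f e with ∨-true {f zero} e
... | inj₁ f₀ = zero , f₀
... | inj₂ fs with anyB-sound (λ k → f (suc k)) fs
...   | k , fk = suc k , fk

anyB-complete : ∀ {m} (f : Fin m → Bool) k → f k ≡ true → anyB f ≡ true
anyB-complete f zero    fk rewrite fk = refl
anyB-complete f (suc k) fk with f zero
... | true  = refl
... | false = anyB-complete (λ k → f (suc k)) k fk

all-or-one : ∀ {k} {A : Fin k → Set} {B : Set} → (∀ i → A i ⊎ B) → (∀ i → A i) ⊎ B
all-or-one {zero}  h = inj₁ (λ ())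
all-or-one {suc k} h with h zero | all-or-one (λ i → h (suc i))
... | inj₂ b | _      = inj₂ b
... | inj₁ _ | inj₂ b = inj₂ b
... | inj₁ a | inj₁ f = inj₁ (λ { zero → a ; (suc i) → f i })

_⊆_ : ∀ {n} → (Fin n → Bool) → (Fin n → Bool) → Set
J ⊆ I = ∀ i → J i ≡ true → I i ≡ true

card : ∀ {n} → (Fin n → Bool) → ℕ
card {zero}  I = 0
card {suc n} I = (if I zero then 1 else 0) ℕ.+ card (λ i → I (suc i))

card≤n : ∀ {n} (I : Fin n → Bool) → card I ℕ.≤ n
card≤n {zero}  I = ℕ.z≤n
card≤n {suc n} I with I zero
... | true  = ℕ.s≤s (card≤n _)
... | false = ℕP.m≤n⇒m≤1+n (card≤n _)

card-mono : ∀ {n} (J I : Fin n → Bool) → J ⊆ I → card J ℕ.≤ card I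
card-mono {zero}  J I J⊆I = ℕ.z≤n
card-mono {suc n} J I J⊆I with J zero in J₀ | I zero in I₀
... | true  | true  = ℕ.s≤s (card-mono _ _ (λ i → J⊆I (suc i)))
... | true  | false = ⊥-elim (true≢false (trans (sym (J⊆I zero J₀)) I₀))
... | false | true  = ℕP.m≤n⇒m≤1+n (card-mono _ _ (λ i → J⊆I (suc i)))
... | false | false = card-mono _ _ (λ i → J⊆I (suc i))

card-strict : ∀ {n} (J I : Fin n → Bool) → J ⊆ I → ∀ v → I v ≡ true → J v ≡ false → card J ℕ.< card I
card-strict {suc n} J I J⊆I zero Iv Jv rewrite Iv | Jv = ℕ.s≤s (card-mono _ _ (λ i → J⊆I (suc i)))
card-strict {suc n} J I J⊆I (suc v) Iv Jv with J zero in J₀ | I zero in I₀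
... | true  | true  = ℕ.s≤s (card-strict _ _ (λ i → J⊆I (suc i)) v Iv Jv)
... | true  | false = ⊥-elim (true≢false (trans (sym (J⊆I zero J₀)) I₀))
... | false | true  = ℕ.s≤s (ℕP.<⇒≤ (card-strict _ _ (λ i → J⊆I (suc i)) v Iv Jv))
... | false | false = card-strict _ _ (λ i → J⊆I (suc i)) v Iv Jv

card-pos : ∀ {n} (I : Fin n → Bool) v → I v ≡ true → 1 ℕ.≤ card I
card-pos I v Iv = ℕP.≤-trans (ℕ.s≤s ℕ.z≤n) (card-strict (λ _ → false) I (λ _ ()) v Iv refl)

module Connectivity {n m : ℕ} (G : SimpleGraph n m) where
  open SimpleGraph G

  reach-in : ∀ {ok S u v} → S u ≡ true → Reach G ok S u v → S v ≡ true
  reach-in Su here          = Su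
  reach-in Su (fwd _ _ Sv _) = Sv
  reach-in Su (bwd _ _ Sv _) = Sv

  reach-trans : ∀ {ok S u v w} → Reach G ok S u v → Reach G ok S v w → Reach G ok S u w
  reach-trans p here           = p
  reach-trans p (fwd k o s q) = fwd k o s (reach-trans p q)
  reach-trans p (bwd k o s q) = bwd k o s (reach-trans p q)

  reach-sym : ∀ {ok S u v} → S u ≡ true → Reach G ok S u v → Reach G ok S v u
  reach-sym Su here          = here
  reach-sym Su (fwd k o _ p) = reach-trans (bwd k o (reach-in Su p) here) (reach-sym Su p)
  reach-sym Su (bwd k o _ p) = reach-trans (fwd k o (reach-in Su p) here) (reach-sym Su p)

  reach-mono : ∀ {ok ok' S S' u v} → (∀ k → ok k ≡ true → ok' k ≡ true) → S ⊆ S' →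
    Reach G ok S u v → Reach G ok' S' u v
  reach-mono ho hs here          = here
  reach-mono ho hs (fwd k o s p) = fwd k (ho k o) (hs _ s) (reach-mono ho hs p)
  reach-mono ho hs (bwd k o s p) = bwd k (ho k o) (hs _ s) (reach-mono ho hs p)

  Closed : (Fin m → Bool) → (Fin n → Bool) → (Fin n → Bool) → Set
  Closed ok S T = ∀ k → ok k ≡ true → S (tl k) ≡ true → S (hd k) ≡ true → T (tl k) ≡ T (hd k)

  reach-inv : ∀ {ok S T u v} → Closed ok S T → S u ≡ true → Reach G ok S u v → T u ≡ T v
  reach-inv cl Su here          = refl
  reach-inv cl Su (fwd k o s p) = trans (reach-inv cl Su p) (cl k o (reach-in Su p) s)
  reach-inv cl Su (bwd k o s p) = trans (reach-inv cl Su p) (sym (cl k o s (reach-in Su p)))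

  Split : (Fin m → Bool) → (Fin n → Bool) → (Fin n → Bool) → Set
  Split ok S T = (∃ λ u → S u ≡ true × T u ≡ true) × (∃ λ v → S v ≡ true × T v ≡ false) × Closed ok S T

  module Explore (ok : Fin m → Bool) (S : Fin n → Bool) (u : Fin n) (Su : S u ≡ true) where

    frontier : (Fin n → Bool) → Fin n → Bool
    frontier R v = anyB (λ k → ok k ∧ ((R (tl k) ∧ ⌊ hd k ≟ v ⌋) ∨ (R (hd k) ∧ ⌊ tl k ≟ v ⌋)))

    grow : (Fin n → Bool) → Fin n → Bool
    grow R v = R v ∨ (S v ∧ frontier R v)

    Sound : (Fin n → Bool) → Set
    Sound R = ∀ v → R v ≡ true → Reach G ok S u v

    grow-sound : ∀ R → Sound R → Sound (grow R)
    grow-sound R sound v e with R v in Rv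
    ... | true = sound v Rv
    ... | false with ∧-true {S v} e
    ...   | Sv , F with anyB-sound _ F
    ...     | k , edge with ∧-true {ok k} edge
    ...       | okk , ends with ∨-true {R (tl k) ∧ ⌊ hd k ≟ v ⌋} ends
    ...         | inj₁ fromTail with ∧-true {R (tl k)} fromTail
    ...           | Rt , hv with ≟-sound hv
    ...             | refl = fwd k okk Sv (sound (tl k) Rt)
    grow-sound R sound v e | false | Sv , F | k , edge | okk , ends | inj₂ fromHead
      with ∧-true {R (hd k)} fromHead
    ... | Rh , tv with ≟-sound tv
    ...   | refl = bwd k okk Sv (sound (hd k) Rh)

    grow-⊇ : ∀ R → R ⊆ grow R
    grow-⊇ R v e rewrite e = refl

    frontier-fwd : ∀ R k → ok k ≡ true → R (tl k) ≡ true → frontier R (hd k) ≡ true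
    frontier-fwd R k okk Rt = anyB-complete _ k edge
      where
      edge : ok k ∧ ((R (tl k) ∧ ⌊ hd k ≟ hd k ⌋) ∨ (R (hd k) ∧ ⌊ tl k ≟ hd k ⌋)) ≡ true
      edge rewrite okk | Rt | ≟-refl (hd k) = refl

    frontier-bwd : ∀ R k → ok k ≡ true → R (hd k) ≡ true → frontier R (tl k) ≡ true
    frontier-bwd R k okk Rh = anyB-complete _ k edge
      where
      orTrue : ∀ b → b ∨ true ≡ true
      orTrue true  = refl
      orTrue false = refl
      edge : ok k ∧ ((R (tl k) ∧ ⌊ hd k ≟ tl k ⌋) ∨ (R (hd k) ∧ ⌊ tl k ≟ tl k ⌋)) ≡ true
      edge rewrite okk | Rh | ≟-refl (tl k) = orTrue _

    newVertex : ∀ R v → R v ≡ false → S v ≡ true → frontier R v ≡ true → (grow R v ∧ not (R v)) ≡ true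
    newVertex R v Rv Sv Fv rewrite Rv | Sv | Fv = refl

    stable⇒closed : ∀ R → (∀ v → (grow R v ∧ not (R v)) ≡ false) → Closed ok S R
    stable⇒closed R stable k okk St Sh with R (tl k) in Rt | R (hd k) in Rh
    ... | true  | true  = refl
    ... | false | false = refl
    ... | true  | false =
      ⊥-elim (true≢false (trans (sym (newVertex R (hd k) Rh Sh (frontier-fwd R k okk Rt))) (stable (hd k))))
    ... | false | true  =
      ⊥-elim (true≢false (trans (sym (newVertex R (tl k) Rt St (frontier-bwd R k okk Rh))) (stable (tl k))))

    Result : Set
    Result = (∀ v → S v ≡ true → Reach G ok S u v) ⊎ Σ (Fin n → Bool) (Split ok S)

    -- Grow R until it is stable; the fuel bounds the number of new vertices.
    explore : ∀ fuel R → Sound R → R u ≡ true → n ℕ.< card R ℕ.+ fuel → Result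
    explore zero R sound Ru n<card =
      ⊥-elim (ℕP.<-irrefl refl (ℕP.<-≤-trans n<card (subst (ℕ._≤ n) (sym (ℕP.+-identityʳ _)) (card≤n R))))
    explore (suc fuel) R sound Ru n<card with search (λ v → grow R v ∧ not (R v))
    ... | inj₁ (v , new) = explore fuel (grow R) (grow-sound R sound) (grow-⊇ R u Ru)
          (ℕP.<-≤-trans n<card (subst (ℕ._≤ card (grow R) ℕ.+ fuel) (sym (ℕP.+-suc (card R) fuel))
             (ℕP.+-monoˡ-≤ fuel (card-strict R (grow R) (grow-⊇ R) v (proj₁ (∧-true new)) (not-true (proj₂ (∧-true new)))))))
    ... | inj₂ stable with search (λ v → S v ∧ not (R v))
    ...   | inj₁ (v , missed) =
            inj₂ (R , (u , Su , Ru) , (v , proj₁ (∧-true missed) , not-true (proj₂ (∧-true missed))) , stable⇒closed R stable)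
    ...   | inj₂ covered = inj₁ (λ v Sv → sound v (inR v Sv))
      where
      inR : ∀ v → S v ≡ true → R v ≡ true
      inR v Sv with R v in Rv | covered v
      ... | true  | _ = refl
      ... | false | c rewrite Sv = ⊥-elim (true≢false c)

    reachAll : Result
    reachAll = explore n (λ v → ⌊ v ≟ u ⌋) start (≟-refl u)
      (ℕP.<-≤-trans (ℕP.n<1+n n) (ℕP.+-monoˡ-≤ n (card-pos (λ v → ⌊ v ≟ u ⌋) u (≟-refl u))))
      where
      start : Sound (λ v → ⌊ v ≟ u ⌋)
      start v e with ≟-sound e
      ... | refl = here

  decConn : ∀ ok S → ConnectedOn G ok S ⊎ Σ (Fin n → Bool) (Split ok S)
  decConn ok S with all-or-one {A = λ u → S u ≡ true → ∀ v → S v ≡ true → Reach G ok S u v} fromEach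
    where
    fromEach : ∀ u → (S u ≡ true → ∀ v → S v ≡ true → Reach G ok S u v) ⊎ Σ (Fin n → Bool) (Split ok S)
    fromEach u with S u in Su
    ... | false = inj₁ (λ ())
    ... | true with Explore.reachAll ok S u Su
    ...   | inj₁ all = inj₁ (λ _ → all)
    ...   | inj₂ sp  = inj₂ sp
  ... | inj₁ all = inj₁ (λ u v Su Sv → all u Su v Sv)
  ... | inj₂ sp  = inj₂ sp

  module Enlarge (conn : Connected G) (I T : Fin n → Bool) (w₀ : Fin n) (Iw₀ : I w₀ ≡ true)
    (connI : InducedConnected G I) (closedT : Closed (allE G) (λ i → not (I i)) T) where

    X : Fin n → Bool
    X i = I i ∨ (not (I i) ∧ T i)

    I⊆X : I ⊆ X
    I⊆X i e rewrite e = refl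

    tail∈X : ∀ k → I (hd k) ≡ false → T (hd k) ≡ true → X (tl k) ≡ true
    tail∈X k Ih Th with I (tl k) in It
    ... | true  = refl
    ... | false = trans (closedT k refl (cong not It) (cong not Ih)) Th

    head∈X : ∀ k → I (tl k) ≡ false → T (tl k) ≡ true → X (hd k) ≡ true
    head∈X k It Tt with I (hd k) in Ih
    ... | true  = refl
    ... | false = trans (sym (closedT k refl (cong not It) (cong not Ih))) Tt

    reroute : ∀ {w} → Reach G (allE G) (allV G) w₀ w → X w ≡ true → Reach G (allE G) X w₀ w
    reroute {w} p Xw with I w in Iw
    reroute {w} p Xw | true = reach-mono (λ _ e → e) I⊆X (connI w₀ w Iw₀ Iw)
    reroute here Xw | false = ⊥-elim (true≢false (trans (sym Iw₀) Iw))
    reroute (fwd k _ _ q) Xw | false =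
      fwd k refl (trans (cong (λ z → z ∨ (not z ∧ T _)) Iw) Xw) (reroute q (tail∈X k Iw Xw))
    reroute (bwd k _ _ q) Xw | false =
      bwd k refl (trans (cong (λ z → z ∨ (not z ∧ T _)) Iw) Xw) (reroute q (head∈X k Iw Xw))

    X-connected : InducedConnected G X
    X-connected a b Xa Xb = reach-trans (reach-sym (I⊆X w₀ Iw₀) (reroute (conn w₀ a refl refl) Xa))
                                        (reroute (conn w₀ b refl refl) Xb)

-- A cut I
-- whose side G[I] is disconnected splits along a set T into two smaller cuts
-- whose demands and capacities add up to those of I; a cut whose other side
-- G[V ∖ I] is disconnected splits into two larger cuts I ∪ (side of V ∖ I)
-- whose demands and capacities add up to those of I plus the whole vertex
-- set (which contributes 0).  Induction on |I| resp. |V ∖ I| finishes.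

arcCap-diag : ∀ (l u : ℤ) b → arcCap l u b b ≡ 0ℤ
arcCap-diag l u true  = refl
arcCap-diag l u false = refl

arcCap-splitInside : ∀ {l u : ℤ} a b s t → (a ≡ true → b ≡ true → s ≡ t) →
  arcCap l u (a ∧ s) (b ∧ t) + arcCap l u (a ∧ not s) (b ∧ not t) ≡ arcCap l u a b
arcCap-splitInside true  true  true  true  _  = refl
arcCap-splitInside true  true  true  false st = ⊥-elim (true≢false (st refl refl))
arcCap-splitInside true  true  false true  st = ⊥-elim (true≢false (sym (st refl refl)))
arcCap-splitInside true  true  false false _  = refl
arcCap-splitInside {u = u} true  false true  _ _ = +-identityʳ u
arcCap-splitInside {u = u} true  false false _ _ = +-identityˡ u
arcCap-splitInside {l} false true  _ true  _ = +-identityʳ (- l)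
arcCap-splitInside {l} false true  _ false _ = +-identityˡ (- l)
arcCap-splitInside false false _ _ _ = refl

arcCap-splitOutside : ∀ {l u : ℤ} a b s t → (not a ≡ true → not b ≡ true → s ≡ t) →
  arcCap l u (a ∨ (not a ∧ s)) (b ∨ (not b ∧ t)) + arcCap l u (a ∨ (not a ∧ not s)) (b ∨ (not b ∧ not t))
    ≡ arcCap l u a b
arcCap-splitOutside true  true  _ _ _ = refl
arcCap-splitOutside {u = u} true  false _ true  _ = +-identityˡ u
arcCap-splitOutside {u = u} true  false _ false _ = +-identityʳ u
arcCap-splitOutside {l} false true  true  _ _ = +-identityˡ (- l)
arcCap-splitOutside {l} false true  false _ _ = +-identityʳ (- l)
arcCap-splitOutside false false true  true  _  = refl
arcCap-splitOutside false false true  false st = ⊥-elim (true≢false (st refl refl))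
arcCap-splitOutside false false false true  st = ⊥-elim (true≢false (sym (st refl refl)))
arcCap-splitOutside false false false false _  = refl

ΣOn-splitInside : ∀ {n} (D : Fin n → ℤ) (I T : Fin n → Bool) →
  ΣOn D (λ i → I i ∧ T i) + ΣOn D (λ i → I i ∧ not (T i)) ≡ ΣOn D I
ΣOn-splitInside D I T = trans (sym (Σ-+ (restrict D (λ i → I i ∧ T i)) (restrict D (λ i → I i ∧ not (T i))))) (Σ-cong pointwise)
  where
  pointwise : ∀ i → restrict D (λ j → I j ∧ T j) i + restrict D (λ j → I j ∧ not (T j)) i ≡ restrict D I i
  pointwise i with I i | T i
  ... | true  | true  = +-identityʳ (D i)
  ... | true  | false = +-identityˡ (D i)
  ... | false | _     = refl

ΣOn-splitOutside : ∀ {n} (D : Fin n → ℤ) (I T : Fin n → Bool) →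
  ΣOn D (λ i → I i ∨ (not (I i) ∧ T i)) + ΣOn D (λ i → I i ∨ (not (I i) ∧ not (T i))) ≡ ΣOn D I + Σ[ D ]
ΣOn-splitOutside D I T =
  trans (sym (Σ-+ (restrict D (λ i → I i ∨ (not (I i) ∧ T i))) (restrict D (λ i → I i ∨ (not (I i) ∧ not (T i))))))
        (trans (Σ-cong pointwise) (Σ-+ (restrict D I) D))
  where
  pointwise : ∀ i → restrict D (λ j → I j ∨ (not (I j) ∧ T j)) i + restrict D (λ j → I j ∨ (not (I j) ∧ not (T j))) i
                  ≡ restrict D I i + D i
  pointwise i with I i | T i
  ... | true  | _     = refl
  ... | false | true  = trans (+-identityʳ (D i)) (sym (+-identityˡ (D i)))
  ... | false | false = refl

module CutReduction {n m : ℕ} (G : SimpleGraph n m) (conn : Connected G)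
  (D : Fin n → ℤ) (ΣD≡0 : Σ[ D ] ≡ 0ℤ) (l u : Fin m → ℤ) where
  open SimpleGraph G
  open Connectivity G

  P : (Fin n → Bool) → Set
  P I = ΣOn D I ≤ cutCap tl hd l u I

  cutCap-constant : ∀ I b → (∀ i → I i ≡ b) → cutCap tl hd l u I ≡ 0ℤ
  cutCap-constant I b h = Σ-vanish (λ k → trans (cong₂ (arcCap (l k) (u k)) (h (tl k)) (h (hd k))) (arcCap-diag (l k) (u k) b))

  splitInside : ∀ I T → Closed (allE G) I T → P (λ i → I i ∧ T i) → P (λ i → I i ∧ not (T i)) → P I
  splitInside I T closed p₁ p₂ = subst₂ _≤_ (ΣOn-splitInside D I T) capacity (+-mono-≤ p₁ p₂)
    where
    capacity : cutCap tl hd l u (λ i → I i ∧ T i) + cutCap tl hd l u (λ i → I i ∧ not (T i)) ≡ cutCap tl hd l u I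
    capacity = trans (sym (Σ-+ (arcCapOf tl hd l u (λ i → I i ∧ T i)) (arcCapOf tl hd l u (λ i → I i ∧ not (T i)))))
      (Σ-cong (λ k → arcCap-splitInside (I (tl k)) (I (hd k)) (T (tl k)) (T (hd k)) (closed k refl)))

  splitOutside : ∀ I T → Closed (allE G) (λ i → not (I i)) T →
    P (λ i → I i ∨ (not (I i) ∧ T i)) → P (λ i → I i ∨ (not (I i) ∧ not (T i))) → P I
  splitOutside I T closed p₁ p₂ = subst₂ _≤_ demand capacity (+-mono-≤ p₁ p₂)
    where
    demand : ΣOn D (λ i → I i ∨ (not (I i) ∧ T i)) + ΣOn D (λ i → I i ∨ (not (I i) ∧ not (T i))) ≡ ΣOn D I
    demand = trans (ΣOn-splitOutside D I T) (trans (cong (_+_ (ΣOn D I)) ΣD≡0) (+-identityʳ _))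
    capacity : cutCap tl hd l u (λ i → I i ∨ (not (I i) ∧ T i)) + cutCap tl hd l u (λ i → I i ∨ (not (I i) ∧ not (T i)))
               ≡ cutCap tl hd l u I
    capacity = trans (sym (Σ-+ (arcCapOf tl hd l u (λ i → I i ∨ (not (I i) ∧ T i)))
                                (arcCapOf tl hd l u (λ i → I i ∨ (not (I i) ∧ not (T i))))))
      (Σ-cong (λ k → arcCap-splitOutside (I (tl k)) (I (hd k)) (T (tl k)) (T (hd k)) (closed k refl)))

  module FromConnectedCuts (connectedCuts : ∀ I → (∃ λ i → I i ≡ true) → (∃ λ i → I i ≡ false) →
      InducedConnected G I → InducedConnected G (λ i → not (I i)) → P I) where

    connectedInside : ∀ fuel I → card (λ i → not (I i)) ℕ.≤ fuel →
      (∃ λ i → I i ≡ true) → (∃ λ i → I i ≡ false) → InducedConnected G I → P I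
    connectedInside zero I small _ (v , Iv) _ =
      ⊥-elim (ℕP.<-irrefl refl (ℕP.<-≤-trans (card-pos (λ i → not (I i)) v (cong not Iv)) small))
    connectedInside (suc fuel) I small (w₀ , Iw₀) outside connI with decConn (allE G) (λ i → not (I i))
    ... | inj₁ connOut = connectedCuts I (w₀ , Iw₀) outside connI connOut
    ... | inj₂ (T , (a , outA , Ta) , (b , outB , Tb) , closed) =
      splitOutside I T closed (enlarged T closed a b outA Ta outB Tb)
        (enlarged (λ i → not (T i)) (λ k o s₁ s₂ → cong not (closed k o s₁ s₂)) b a outB (cong not Tb) outA (cong not Ta))
      where
      enlarged : ∀ T' → Closed (allE G) (λ i → not (I i)) T' → ∀ v v' →
        not (I v) ≡ true → T' v ≡ true → not (I v') ≡ true → T' v' ≡ false → P (λ i → I i ∨ (not (I i) ∧ T' i))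
      enlarged T' closedT' v v' outV T'v outV' T'v' = connectedInside fuel X smaller (w₀ , I⊆X w₀ Iw₀) (v' , Xv') X-connected
        where
        open Connectivity.Enlarge G conn I T' w₀ Iw₀ connI closedT'
        Xv : X v ≡ true
        Xv rewrite not-true outV | T'v = refl
        Xv' : X v' ≡ false
        Xv' rewrite not-true outV' | T'v' = refl
        shrinks : (λ i → not (X i)) ⊆ (λ i → not (I i))
        shrinks i e with I i
        ... | true  = ⊥-elim (true≢false (sym e))
        ... | false = refl
        smaller : card (λ i → not (X i)) ℕ.≤ fuel
        smaller = ℕP.≤-pred (ℕP.≤-trans (card-strict (λ i → not (X i)) (λ i → not (I i)) shrinks v outV (cong not Xv)) small)

    allCutsBelow : ∀ fuel I → card I ℕ.≤ fuel → P I
    allCutsBelow fuel I small with search I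
    ... | inj₂ empty = ≤-reflexive (trans (ΣOn-empty D I empty) (sym (cutCap-constant I false empty)))
    ... | inj₁ (w₀ , Iw₀) with search (λ i → not (I i))
    ...   | inj₂ full = ≤-reflexive (trans (trans (ΣOn-full D I (λ i → not-false (full i))) ΣD≡0)
                                           (sym (cutCap-constant I true (λ i → not-false (full i)))))
    ...   | inj₁ (v₀ , outV₀) with decConn (allE G) I
    ...     | inj₁ connI = connectedInside n I (card≤n _) (w₀ , Iw₀) (v₀ , not-true outV₀) connI
    allCutsBelow zero I small | inj₁ (w₀ , Iw₀) | inj₁ _ | inj₂ _ =
      ⊥-elim (ℕP.<-irrefl refl (ℕP.<-≤-trans (card-pos I w₀ Iw₀) small))
    allCutsBelow (suc fuel) I small | inj₁ _ | inj₁ _ | inj₂ (T , (a , Ia , Ta) , (b , Ib , Tb) , closed) =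
      splitInside I T closed
        (allCutsBelow fuel _ (smaller T b Ib (cong₂ _∧_ Ib Tb)))
        (allCutsBelow fuel _ (smaller (λ i → not (T i)) a Ia (cong₂ (λ x y → x ∧ not y) Ia Ta)))
      where
      smaller : ∀ T' v → I v ≡ true → (I v ∧ T' v) ≡ false → card (λ i → I i ∧ T' i) ℕ.≤ fuel
      smaller T' v Iv missesV =
        ℕP.≤-pred (ℕP.≤-trans (card-strict _ I (λ i e → proj₁ (∧-true e)) v Iv missesV) small)

    allCuts : ∀ I → P I
    allCuts I = allCutsBelow n I (card≤n I)

  -- At a bridge k the cut condition already forces l_k ≤ u_k: the two
  -- sides T, V ∖ T of G - k give 0 = D(T) + D(V ∖ T) ≤ u_k - l_k.
  bridge : (∀ I → P I) → ∀ k → Σ (Fin n → Bool) (Split (λ k' → not ⌊ k' ≟ k ⌋) (allV G)) → l k ≤ u k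
  bridge allP k (T , (a , _ , Ta) , (b , _ , Tb) , closed) = byEnds (T (tl k)) (T (hd k)) refl refl
    where
    others : ∀ k' → k' ≢ k → T (tl k') ≡ T (hd k')
    others k' k'≢k = closed k' (cong not (≟-≢ k'≢k)) refl refl
    onlyK : ∀ T' → (∀ k' → k' ≢ k → T' (tl k') ≡ T' (hd k')) →
      cutCap tl hd l u T' ≡ arcCap (l k) (u k) (T' (tl k)) (T' (hd k))
    onlyK T' h = Σ-single _ k (λ k' k'≢k →
      trans (cong (arcCap (l k') (u k') (T' (tl k'))) (sym (h k' k'≢k))) (arcCap-diag (l k') (u k') (T' (tl k'))))
    bothSides : Bool → Bool → ℤ
    bothSides bt bh = arcCap (l k) (u k) bt bh + arcCap (l k) (u k) (not bt) (not bh)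
    both : 0ℤ ≤ bothSides (T (tl k)) (T (hd k))
    both = subst₂ _≤_ (trans (ΣOn-compl D T) ΣD≡0)
      (cong₂ _+_ (onlyK T others) (onlyK (λ i → not (T i)) (λ k' k'≢k → cong not (others k' k'≢k))))
      (+-mono-≤ (allP T) (allP (λ i → not (T i))))
    -- k must cross T, for otherwise T would split the connected graph G.
    crosses : T (tl k) ≡ T (hd k) → ⊥
    crosses same = true≢false (trans (sym Ta) (trans (reach-inv closedInG refl (conn a b refl refl)) Tb))
      where
      closedInG : Closed (allE G) (allV G) T
      closedInG k' _ _ _ with k' ≟ k
      ... | yes refl  = same
      ... | no k'≢k = others k' k'≢k
    byEnds : ∀ bt bh → T (tl k) ≡ bt → T (hd k) ≡ bh → l k ≤ u k
    byEnds true  true  Tt Th = ⊥-elim (crosses (trans Tt (sym Th)))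
    byEnds false false Tt Th = ⊥-elim (crosses (trans Tt (sym Th)))
    byEnds true  false Tt Th = 0≤i-j⇒j≤i (subst (0ℤ ≤_) (cong₂ bothSides Tt Th) both)
    byEnds false true  Tt Th = 0≤i-j⇒j≤i (subst (0ℤ ≤_) (trans (cong₂ bothSides Tt Th) (+-comm (- l k) (u k))) both)

-- For an edge with tail-in-I bit it, head-in-I
-- bit ih and J-bit j, the left-hand side of (2) receives sTerm · s_k and the
-- right-hand side receives boundTerm (these are the summands of lhs2, rhs2).

sTerm : Bool → Bool → Bool → ℤ → ℤ
sTerm it ih j S = (if (it xor ih) ∧ not j then S else 0ℤ) + - (if j then S else 0ℤ)

boundTerm : Bool → Bool → Bool → ℤ → ℤ → ℤ → ℤ → ℤ
boundTerm it ih j a b c d =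
    ((+ 2 * (if not j ∧ it ∧ not ih then b else 0ℤ) + - (+ 2 * (if j ∧ not it ∧ ih then a else 0ℤ)))
  + + 2 * (if not j ∧ not it ∧ ih then d else 0ℤ)) + - (+ 2 * (if j ∧ it ∧ not ih then c else 0ℤ))

-- The bounds on x_k = s_k - y_k selected by j: j = true uses a_k ≤ x_k and
-- c_k ≤ y_k, j = false uses y_k ≤ d_k and x_k ≤ b_k.
lowerBy : Bool → (a d S : ℤ) → ℤ
lowerBy j a d S = if j then a else S - d

upperBy : Bool → (b c S : ℤ) → ℤ
upperBy j b c S = if j then S - c else b

-- The key identity: for a crossing edge (or j = false), the slack of (2)
-- plus the edge's part of (N₀ s)(I) is twice the capacity of the edge for
-- the bounds selected by j.
edgeBudget : ∀ it ih j → (j ≡ true → (it xor ih) ≡ true) → ∀ (a b c d S : ℤ) →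
  boundTerm it ih j a b c d + - sTerm it ih j S + S * (ind it - ind ih)
    ≡ + 2 * arcCap (lowerBy j a d S) (upperBy j b c S) it ih
edgeBudget true  true  true  cross _ _ _ _ _ = ⊥-elim (true≢false (sym (cross refl)))
edgeBudget false false true  cross _ _ _ _ _ = ⊥-elim (true≢false (sym (cross refl)))
edgeBudget true  true  false _ a b c d S = internal S
  where
  internal : ∀ S → 0ℤ + S * 0ℤ ≡ 0ℤ
  internal = solve-∀
edgeBudget false false false _ a b c d S = internal S
  where
  internal : ∀ S → 0ℤ + S * 0ℤ ≡ 0ℤ
  internal = solve-∀
edgeBudget true  false true  _ a b c d S = leavingInJ c S
  where
  leavingInJ : ∀ c S → 0ℤ + - (+ 2 * c) + - (0ℤ + - S) + S * 1ℤ ≡ + 2 * (S - c)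
  leavingInJ = solve-∀
edgeBudget true  false false _ a b c d S = leaving b S
  where
  leaving : ∀ b S → + 2 * b + 0ℤ + 0ℤ + 0ℤ + - (S + 0ℤ) + S * 1ℤ ≡ + 2 * b
  leaving = solve-∀
edgeBudget false true  true  _ a b c d S = enteringInJ a S
  where
  enteringInJ : ∀ a S → 0ℤ + - (+ 2 * a) + 0ℤ + 0ℤ + - (0ℤ + - S) + S * -1ℤ ≡ + 2 * (- a)
  enteringInJ = solve-∀
edgeBudget false true  false _ a b c d S = entering d S
  where
  entering : ∀ d S → 0ℤ + + 2 * d + 0ℤ + - (S + 0ℤ) + S * -1ℤ ≡ + 2 * (- (S - d))
  entering = solve-∀

arcFlow≤arcCap : ∀ {lo up x : ℤ} → lo ≤ x → x ≤ up → ∀ it ih → x * (ind it - ind ih) ≤ arcCap lo up it ih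
arcFlow≤arcCap {x = x} lo≤x x≤up true  true  = ≤-reflexive (*-zeroʳ x)
arcFlow≤arcCap {x = x} lo≤x x≤up true  false = subst (_≤ _) (sym (*-identityʳ x)) x≤up
arcFlow≤arcCap {x = x} lo≤x x≤up false true  =
  subst (_≤ _) (trans (sym (-1*i≡-i x)) (*-comm -1ℤ x)) (neg-mono-≤ lo≤x)
arcFlow≤arcCap {x = x} lo≤x x≤up false false = ≤-reflexive (*-zeroʳ x)

-- Necessity of (2), edge by edge: with s_k = x_k + y_k and r = N₀(x - y),
-- the edge contributes (x - y)·δ + sTerm·s to the left and boundTerm to the
-- right, where δ = ind it - ind ih.
edgeNecessary : ∀ it ih j → (j ≡ true → (it xor ih) ≡ true) → ∀ {a b c d x y : ℤ} →
  a ≤ x → x ≤ b → c ≤ y → y ≤ d →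
  (x - y) * (ind it - ind ih) + sTerm it ih j (x + y) ≤ boundTerm it ih j a b c d
edgeNecessary it ih j cross {a} {b} {c} {d} {x} {y} a≤x x≤b c≤y y≤d =
  ≤-shift (α - (x + y) * δ) twiceFlow (regroupL x y δ α) (regroupR x y δ α β)
  where
  δ α β : ℤ
  δ = ind it - ind ih
  α = sTerm it ih j (x + y)
  β = boundTerm it ih j a b c d
  inBounds : ∀ j′ → lowerBy j′ a d (x + y) ≤ x × x ≤ upperBy j′ b c (x + y)
  inBounds true  = a≤x , ≤-move-add (+-monoʳ-≤ x c≤y)
  inBounds false = ≤-move-sub (+-monoʳ-≤ x y≤d) , x≤b
  twiceFlow : + 2 * (x * δ) ≤ β + - α + (x + y) * δ
  twiceFlow = subst (_ ≤_) (sym (edgeBudget it ih j cross a b c d (x + y)))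
    (*-monoˡ-≤-nonNeg (+ 2) (arcFlow≤arcCap (proj₁ (inBounds j)) (proj₂ (inBounds j)) it ih))
  regroupL : ∀ x y δ α → (x - y) * δ + α ≡ + 2 * (x * δ) + (α - (x + y) * δ)
  regroupL = solve-∀
  regroupR : ∀ x y δ α β → β ≡ β + - α + (x + y) * δ + (α - (x + y) * δ)
  regroupR = solve-∀

-- Choosing J optimally for a cut I: an edge leaving I is put in J according
-- to a test cA, an edge entering I according to a test cB.  The capacity
-- for the selected bounds then only depends on cA and cB, not on I.
edgeOptimal : ∀ it ih (cA cB : Bool) (a b c d S : ℤ) →
  let j = (it xor ih) ∧ (if it then cA else cB) in
  arcCap (lowerBy j a d S) (upperBy j b c S) it ih
    ≡ arcCap (lowerBy cB a d S) (upperBy cA b c S) it ih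
edgeOptimal true  true  _ _ _ _ _ _ _ = refl
edgeOptimal true  false _ _ _ _ _ _ _ = refl
edgeOptimal false true  _ _ _ _ _ _ _ = refl
edgeOptimal false false _ _ _ _ _ _ _ = refl

-- With the tests cB = (S - d ≤ a) and cA = (S - c ≤ b) the selected bounds
-- are max(a, S - d) and min(b, S - c).
selectedLower : ∀ (a d S : ℤ) {x : ℤ} → lowerBy ⌊ S - d ≤? a ⌋ a d S ≤ x → a ≤ x × S - d ≤ x
selectedLower a d S lo≤x with S - d ≤? a
... | yes S-d≤a = lo≤x , ≤-trans S-d≤a lo≤x
... | no  S-d≰a = ≤-trans (<⇒≤ (≰⇒> S-d≰a)) lo≤x , lo≤x

selectedUpper : ∀ (b c S : ℤ) {x : ℤ} → x ≤ upperBy ⌊ S - c ≤? b ⌋ b c S → x ≤ b × x ≤ S - c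
selectedUpper b c S x≤up with S - c ≤? b
... | yes S-c≤b = ≤-trans x≤up S-c≤b , x≤up
... | no  S-c≰b = x≤up , ≤-trans x≤up (<⇒≤ (≰⇒> S-c≰b))

selectedBounds : ∀ {a b c d S : ℤ} → c ≤ d → a ≤ b → a + c ≤ S → S ≤ b + d →
  lowerBy ⌊ S - d ≤? a ⌋ a d S ≤ upperBy ⌊ S - c ≤? b ⌋ b c S
selectedBounds {a} {b} {c} {d} {S} c≤d a≤b a+c≤S S≤b+d with S - c ≤? b | S - d ≤? a
... | yes _ | yes _ = ≤-move-add a+c≤S
... | yes _ | no _  = +-monoʳ-≤ S (neg-mono-≤ c≤d)
... | no _  | yes _ = a≤b
... | no _  | no _  = ≤-move-sub S≤b+d

module Theorem {n m : ℕ} (G : SimpleGraph n m) where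
  open SimpleGraph G

  tl≢hd : ∀ k → tl k ≢ hd k
  tl≢hd k e = ℕP.<-irrefl (cong toℕ e) (tl<hd k)

  gCoordinate : ∀ (x y : Fin m → ℤ) j → Σ[ (λ k → x k * zg G k j + y k * z'g G k j) ] ≡ x j + y j
  gCoordinate x y j = trans (Σ-single _ j offDiagonal) onDiagonal
    where
    offDiagonal : ∀ k → k ≢ j → x k * zg G k j + y k * z'g G k j ≡ 0ℤ
    offDiagonal k k≢j rewrite ≟-≢ {i = j} {p = k} (λ j≡k → k≢j (sym j≡k)) =
      cong₂ _+_ (*-zeroʳ (x k)) (*-zeroʳ (y k))
    onDiagonal : x j * zg G j j + y j * z'g G j j ≡ x j + y j
    onDiagonal rewrite ≟-refl j = cong₂ _+_ (*-identityʳ (x j)) (*-identityʳ (y j))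

  t : (Fin m → ℤ) → (Fin n → ℤ) → Fin n → ℤ
  t s r i = Σ[ (λ k → N₀ G i k * s k) ] + r i

  lhs2-edges : ∀ r s I J → lhs2 G r s I J ≡ ΣOn r I + Σ[ (λ k → sTerm (I (tl k)) (I (hd k)) (J k) (s k)) ]
  lhs2-edges r s I J = trans (+-assoc (ΣOn r I) Σ[ notInJ ] (- Σ[ inJ ]))
    (cong (_+_ (ΣOn r I)) (trans (cong (_+_ Σ[ notInJ ]) (sym (Σ-neg inJ))) (sym (Σ-+ notInJ (λ k → - inJ k)))))
    where
    notInJ inJ : Fin m → ℤ
    notInJ k = if EI G I k ∧ not (J k) then s k else 0ℤ
    inJ k = if J k then s k else 0ℤ

  rhs2-edges : ∀ a b c d I J → rhs2 G a b c d I J ≡ Σ[ (λ k → boundTerm (I (tl k)) (I (hd k)) (J k) (a k) (b k) (c k) (d k)) ]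
  rhs2-edges a b c d I J = sym (begin
    Σ[ (λ k → ((twice B k + - twice A k) + twice D k) + - twice C k) ]
      ≡⟨ Σ-+ (λ k → (twice B k + - twice A k) + twice D k) (λ k → - twice C k) ⟩
    Σ[ (λ k → (twice B k + - twice A k) + twice D k) ] + Σ[ (λ k → - twice C k) ]
      ≡⟨ cong₂ _+_ (trans (Σ-+ (λ k → twice B k + - twice A k) (twice D))
                          (cong₂ _+_ (trans (Σ-+ (twice B) (λ k → - twice A k)) (cong₂ _+_ (Σ-twice B) (Σ-neg-twice A)))
                                     (Σ-twice D)))
                   (Σ-neg-twice C) ⟩
    ((+ 2 * Σ[ B ] + - (+ 2 * Σ[ A ])) + + 2 * Σ[ D ]) + - (+ 2 * Σ[ C ]) ∎)
    where
    open ≡-Reasoning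
    B A D C : Fin m → ℤ
    B k = if not (J k) ∧ I (tl k) ∧ not (I (hd k)) then b k else 0ℤ
    A k = if J k ∧ not (I (tl k)) ∧ I (hd k) then a k else 0ℤ
    D k = if not (J k) ∧ not (I (tl k)) ∧ I (hd k) then d k else 0ℤ
    C k = if J k ∧ I (tl k) ∧ not (I (hd k)) then c k else 0ℤ
    twice : (Fin m → ℤ) → Fin m → ℤ
    twice f k = + 2 * f k
    Σ-twice : ∀ f → Σ[ twice f ] ≡ + 2 * Σ[ f ]
    Σ-twice f = Σ-* (+ 2) f
    Σ-neg-twice : ∀ f → Σ[ (λ k → - twice f k) ] ≡ - (+ 2 * Σ[ f ])
    Σ-neg-twice f = trans (Σ-neg (twice f)) (cong -_ (Σ-twice f))

  -- Necessity: a representation (x, y) satisfies s = x + y and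
  -- t = N₀ s + r = 2 N₀ x, which gives (1); (2) and (3) follow edge by edge.
  module Necessity (r : Fin n → ℤ) (s a b c d x y : Fin m → ℤ)
    (xBounds : ∀ k → a k ≤ x k × x k ≤ b k) (yBounds : ∀ k → c k ≤ y k × y k ≤ d k)
    (rEq : ∀ i → r i ≡ Σ[ (λ k → x k * zf G k i + y k * z'f G k i) ])
    (sEq : ∀ j → s j ≡ Σ[ (λ k → x k * zg G k j + y k * z'g G k j) ]) where

    s≡x+y : ∀ k → s k ≡ x k + y k
    s≡x+y k = trans (sEq k) (gCoordinate x y k)

    r≡divergence : ∀ i → r i ≡ divergence tl hd (λ k → x k - y k) i
    r≡divergence i = trans (rEq i) (Σ-cong (λ k → opposite (N₀ G i k) (x k) (y k)))
      where
      opposite : ∀ N x y → x * N + y * - N ≡ N * (x - y)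
      opposite = solve-∀

    t≡twice : ∀ i → t s r i ≡ + 2 * divergence tl hd x i
    t≡twice i = begin
      Σ[ (λ k → N₀ G i k * s k) ] + r i
        ≡⟨ cong₂ _+_ (Σ-cong (λ k → cong (N₀ G i k *_) (s≡x+y k))) (rEq i) ⟩
      Σ[ (λ k → N₀ G i k * (x k + y k)) ] + Σ[ (λ k → x k * N₀ G i k + y k * - N₀ G i k) ]
        ≡⟨ sym (Σ-+ (λ k → N₀ G i k * (x k + y k)) (λ k → x k * N₀ G i k + y k * - N₀ G i k)) ⟩
      Σ[ (λ k → N₀ G i k * (x k + y k) + (x k * N₀ G i k + y k * - N₀ G i k)) ]
        ≡⟨ Σ-cong (λ k → doubled (N₀ G i k) (x k) (y k)) ⟩
      Σ[ (λ k → + 2 * (N₀ G i k * x k)) ]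
        ≡⟨ Σ-* (+ 2) (λ k → N₀ G i k * x k) ⟩
      + 2 * divergence tl hd x i ∎
      where
      open ≡-Reasoning
      doubled : ∀ N x y → N * (x + y) + (x * N + y * - N) ≡ + 2 * (N * x)
      doubled = solve-∀

    condition1 : (∀ i → + 2 ∣ t s r i) × Σ[ t s r ] ≡ 0ℤ
    condition1 =
      (λ i → subst (+ 2 ∣_) (sym (t≡twice i)) (*-monoʳ-∣ (+ 2) {1ℤ} {divergence tl hd x i} (ℕD.1∣ _))) ,
      trans (Σ-cong t≡twice) (trans (Σ-* (+ 2) (divergence tl hd x))
            (trans (cong (+ 2 *_) (divergence-total tl hd tl≢hd x)) (*-zeroʳ (+ 2))))

    condition2 : ∀ I J → (∀ k → J k ≡ true → EI G I k ≡ true) → lhs2 G r s I J ≤ rhs2 G a b c d I J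
    condition2 I J J⊆EI = subst₂ _≤_ (sym (lhs2-edges r s I J)) (sym (rhs2-edges a b c d I J))
      (subst (_≤ _) (sym perEdge) (Σ-mono (λ k → edgeNecessary (I (tl k)) (I (hd k)) (J k) (J⊆EI k)
        (proj₁ (xBounds k)) (proj₂ (xBounds k)) (proj₁ (yBounds k)) (proj₂ (yBounds k)))))
      where
      δ : Fin m → ℤ
      δ k = ind (I (tl k)) - ind (I (hd k))
      perEdge : ΣOn r I + Σ[ (λ k → sTerm (I (tl k)) (I (hd k)) (J k) (s k)) ]
              ≡ Σ[ (λ k → (x k - y k) * δ k + sTerm (I (tl k)) (I (hd k)) (J k) (x k + y k)) ]
      perEdge = trans (cong₂ _+_ (trans (ΣOn-cong-fun I r≡divergence) (ΣOn-divergence tl hd tl≢hd (λ k → x k - y k) I))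
                                 (Σ-cong (λ k → cong (sTerm (I (tl k)) (I (hd k)) (J k)) (s≡x+y k))))
                      (sym (Σ-+ (λ k → (x k - y k) * δ k) (λ k → sTerm (I (tl k)) (I (hd k)) (J k) (x k + y k))))

    condition3 : ∀ k → (a k + c k ≤ s k) × (s k ≤ b k + d k)
    condition3 k = subst (a k + c k ≤_) (sym (s≡x+y k)) (+-mono-≤ (proj₁ (xBounds k)) (proj₁ (yBounds k))) ,
                   subst (_≤ b k + d k) (sym (s≡x+y k)) (+-mono-≤ (proj₂ (xBounds k)) (proj₂ (yBounds k)))

  -- Sufficiency: Q = t/2 is an admissible demand for Hoffman's theorem
  -- with the bounds lo_k = max(a_k, s_k - d_k) ≤ x_k ≤ up_k = min(b_k, s_k - c_k),
  -- and y = s - x then satisfies c ≤ y ≤ d.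
  module Sufficiency (conn : Connected G) (r : Fin n → ℤ) (s a b c d : Fin m → ℤ)
    (a≤b : ∀ k → a k ≤ b k) (c≤d : ∀ k → c k ≤ d k)
    (cond1 : (∀ i → + 2 ∣ t s r i) × Σ[ t s r ] ≡ 0ℤ)
    (cond2 : ∀ (I : Fin n → Bool) (J : Fin m → Bool) → ∃ (λ i → I i ≡ true) → ∃ (λ i → I i ≡ false) →
             (∀ k → J k ≡ true → EI G I k ≡ true) → InducedConnected G I → InducedConnected G (λ i → not (I i)) →
             lhs2 G r s I J ≤ rhs2 G a b c d I J)
    (cond3 : ∀ k → DeleteConnected G k → (a k + c k ≤ s k) × (s k ≤ b k + d k)) where
    open CutReduction G conn

    halve : ∀ z → + 2 ∣ z → Σ ℤ (λ h → z ≡ + 2 * h)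
    halve z 2∣z with Signed.∣ᵤ⇒∣ 2∣z
    ... | Signed.divides h z≡h*2 = h , trans z≡h*2 (*-comm h (+ 2))

    Q : Fin n → ℤ
    Q i = proj₁ (halve (t s r i) (proj₁ cond1 i))

    t≡2Q : ∀ i → t s r i ≡ + 2 * Q i
    t≡2Q i = proj₂ (halve (t s r i) (proj₁ cond1 i))

    ΣQ≡0 : Σ[ Q ] ≡ 0ℤ
    ΣQ≡0 = *-cancelˡ-≡ (+ 2) Σ[ Q ] 0ℤ
      (trans (sym (Σ-* (+ 2) Q)) (trans (sym (Σ-cong t≡2Q)) (trans (proj₂ cond1) (sym (*-zeroʳ (+ 2))))))

    cA cB : Fin m → Bool
    cA k = ⌊ s k - c k ≤? b k ⌋
    cB k = ⌊ s k - d k ≤? a k ⌋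

    lo up : Fin m → ℤ
    lo k = lowerBy (cB k) (a k) (d k) (s k)
    up k = upperBy (cA k) (b k) (c k) (s k)

    optimalJ : (Fin n → Bool) → Fin m → Bool
    optimalJ I k = EI G I k ∧ (if I (tl k) then cA k else cB k)

    -- Condition (2) for the optimal J is the cut condition for Q at I.
    connectedCut : ∀ I → (∃ λ i → I i ≡ true) → (∃ λ i → I i ≡ false) →
      InducedConnected G I → InducedConnected G (λ i → not (I i)) → ΣOn Q I ≤ cutCap tl hd lo up I
    connectedCut I inside outside connI connOut =
      *-cancelˡ-≤-pos (ΣOn Q I) (cutCap tl hd lo up I) (+ 2) (subst₂ _≤_ twiceDemand twiceCapacity rearranged)
      where
      J : Fin m → Bool
      J = optimalJ I
      δ α β : Fin m → ℤ
      δ k = ind (I (tl k)) - ind (I (hd k))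
      α k = sTerm (I (tl k)) (I (hd k)) (J k) (s k)
      β k = boundTerm (I (tl k)) (I (hd k)) (J k) (a k) (b k) (c k) (d k)
      condJ : ΣOn r I + Σ[ α ] ≤ Σ[ β ]
      condJ = subst₂ _≤_ (lhs2-edges r s I J) (rhs2-edges a b c d I J)
        (cond2 I J inside outside (λ k e → proj₁ (∧-true e)) connI connOut)
      rearranged : Σ[ (λ k → s k * δ k) ] + ΣOn r I ≤ Σ[ (λ k → β k + - α k + s k * δ k) ]
      rearranged = ≤-shift (Σ[ (λ k → s k * δ k) ] - Σ[ α ]) condJ (regroupL (ΣOn r I) Σ[ α ] Σ[ (λ k → s k * δ k) ])
        (trans (Σ-+ (λ k → β k + - α k) (λ k → s k * δ k))
               (trans (cong (_+ Σ[ (λ k → s k * δ k) ]) (trans (Σ-+ β (λ k → - α k)) (cong (_+_ Σ[ β ]) (Σ-neg α))))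
                      (regroupR Σ[ α ] Σ[ β ] Σ[ (λ k → s k * δ k) ])))
        where
        regroupL : ∀ R A F → F + R ≡ (R + A) + (F - A)
        regroupL = solve-∀
        regroupR : ∀ A B F → (B + - A) + F ≡ B + (F - A)
        regroupR = solve-∀
      twiceDemand : Σ[ (λ k → s k * δ k) ] + ΣOn r I ≡ + 2 * ΣOn Q I
      twiceDemand = begin
        Σ[ (λ k → s k * δ k) ] + ΣOn r I
          ≡⟨ cong (_+ ΣOn r I) (sym (ΣOn-divergence tl hd tl≢hd s I)) ⟩
        ΣOn (divergence tl hd s) I + ΣOn r I
          ≡⟨ sym (ΣOn-+ (divergence tl hd s) r I) ⟩
        ΣOn (t s r) I
          ≡⟨ ΣOn-cong-fun I t≡2Q ⟩
        ΣOn (λ i → + 2 * Q i) I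
          ≡⟨ ΣOn-* (+ 2) Q I ⟩
        + 2 * ΣOn Q I ∎
        where open ≡-Reasoning
      twiceCapacity : Σ[ (λ k → β k + - α k + s k * δ k) ] ≡ + 2 * cutCap tl hd lo up I
      twiceCapacity = trans (Σ-cong perEdge) (Σ-* (+ 2) (arcCapOf tl hd lo up I))
        where
        perEdge : ∀ k → β k + - α k + s k * δ k ≡ + 2 * arcCapOf tl hd lo up I k
        perEdge k = trans (edgeBudget (I (tl k)) (I (hd k)) (J k) (λ e → proj₁ (∧-true e)) (a k) (b k) (c k) (d k) (s k))
          (cong (+ 2 *_) (edgeOptimal (I (tl k)) (I (hd k)) (cA k) (cB k) (a k) (b k) (c k) (d k) (s k)))

    allCuts : CutCondition tl hd lo up Q
    allCuts = FromConnectedCuts.allCuts Q ΣQ≡0 lo up connectedCut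

    -- lo ≤ up: by (3) away from bridges, and automatically at bridges.
    lo≤up : ∀ k → lo k ≤ up k
    lo≤up k with Connectivity.decConn G (λ k' → not ⌊ k' ≟ k ⌋) (allV G)
    ... | inj₁ connected = selectedBounds (c≤d k) (a≤b k) (proj₁ (cond3 k connected)) (proj₂ (cond3 k connected))
    ... | inj₂ split     = bridge Q ΣQ≡0 lo up allCuts k split

    flow : Σ (Fin m → ℤ) (λ x → (∀ k → lo k ≤ x k × x k ≤ up k) × (∀ i → Q i ≡ divergence tl hd x i))
    flow = hoffman m tl hd tl≢hd lo up lo≤up Q ΣQ≡0 allCuts

    x y : Fin m → ℤ
    x = proj₁ flow
    y k = s k - x k

    aboveLower : ∀ k → a k ≤ x k × s k - d k ≤ x k
    aboveLower k = selectedLower (a k) (d k) (s k) (proj₁ (proj₁ (proj₂ flow) k))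

    belowUpper : ∀ k → x k ≤ b k × x k ≤ s k - c k
    belowUpper k = selectedUpper (b k) (c k) (s k) (proj₂ (proj₁ (proj₂ flow) k))

    xBounds : ∀ k → a k ≤ x k × x k ≤ b k
    xBounds k = proj₁ (aboveLower k) , proj₁ (belowUpper k)

    yBounds : ∀ k → c k ≤ y k × y k ≤ d k
    yBounds k = ≤-flip-sub {x k} {s k} {c k} (proj₂ (belowUpper k)) ,
                ≤-flip-sub' {s k} {d k} {x k} (proj₂ (aboveLower k))

    rEq : ∀ i → r i ≡ Σ[ (λ k → x k * zf G k i + y k * z'f G k i) ]
    rEq i = sym (begin
      Σ[ (λ k → x k * N₀ G i k + (s k - x k) * - N₀ G i k) ]
        ≡⟨ Σ-cong (λ k → expand (N₀ G i k) (x k) (s k)) ⟩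
      Σ[ (λ k → + 2 * (N₀ G i k * x k) + - (N₀ G i k * s k)) ]
        ≡⟨ Σ-+ (λ k → + 2 * (N₀ G i k * x k)) (λ k → - (N₀ G i k * s k)) ⟩
      Σ[ (λ k → + 2 * (N₀ G i k * x k)) ] + Σ[ (λ k → - (N₀ G i k * s k)) ]
        ≡⟨ cong₂ _+_ (Σ-* (+ 2) (λ k → N₀ G i k * x k)) (Σ-neg (λ k → N₀ G i k * s k)) ⟩
      + 2 * divergence tl hd x i + - divergence tl hd s i
        ≡⟨ cong (λ z → + 2 * z + - divergence tl hd s i) (sym (proj₂ (proj₂ flow) i)) ⟩
      + 2 * Q i + - divergence tl hd s i
        ≡⟨ cong (_+ - divergence tl hd s i) (sym (t≡2Q i)) ⟩
      (divergence tl hd s i + r i) + - divergence tl hd s i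
        ≡⟨ cancel (divergence tl hd s i) (r i) ⟩
      r i ∎)
      where
      open ≡-Reasoning
      expand : ∀ N x s → x * N + (s - x) * - N ≡ + 2 * (N * x) + - (N * s)
      expand = solve-∀
      cancel : ∀ A r → (A + r) + - A ≡ r
      cancel = solve-∀

    sEq : ∀ j → s j ≡ Σ[ (λ k → x k * zg G k j + y k * z'g G k j) ]
    sEq j = sym (trans (gCoordinate x y j) (restore (x j) (s j)))
      where
      restore : ∀ x s → x + (s - x) ≡ s
      restore = solve-∀

theorem4p11 : (n m : ℕ) → 1 ℕ.≤ n → (G : SimpleGraph n m) → Connected G →
    (r : Fin n → ℤ) (s : Fin m → ℤ) (a b c d : Fin m → ℤ) →
    (∀ k → a k ≤ b k) → (∀ k → c k ≤ d k) →
    (Σ (Fin m → ℤ) (λ x → Σ (Fin m → ℤ) (λ y →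
        (∀ k → a k ≤ x k × x k ≤ b k) × (∀ k → c k ≤ y k × y k ≤ d k)
        × (∀ i → r i ≡ Σ[ (λ k → x k * zf G k i + y k * z'f G k i) ])
        × (∀ j → s j ≡ Σ[ (λ k → x k * zg G k j + y k * z'g G k j) ]))))
    ⇔
    (((∀ i → + 2 ∣ (Σ[ (λ k → N₀ G i k * s k) ] + r i))
        × Σ[ (λ i → Σ[ (λ k → N₀ G i k * s k) ] + r i) ] ≡ 0ℤ)
     × (∀ (I : Fin n → Bool) (J : Fin m → Bool) →
          ∃ (λ i → I i ≡ true) → ∃ (λ i → I i ≡ false) →
          (∀ k → J k ≡ true → EI G I k ≡ true) →
          InducedConnected G I → InducedConnected G (λ i → not (I i)) →
          lhs2 G r s I J ≤ rhs2 G a b c d I J)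
     × (∀ k → DeleteConnected G k → (a k + c k ≤ s k) × (s k ≤ b k + d k)))
theorem4p11 n m _ G conn r s a b c d a≤b c≤d = mk⇔
  (λ { (x , y , xBounds , yBounds , rEq , sEq) →
       let open Theorem.Necessity G r s a b c d x y xBounds yBounds rEq sEq in
       condition1 , (λ I J _ _ J⊆EI _ _ → condition2 I J J⊆EI) , (λ k _ → condition3 k) })
  (λ { (cond1 , cond2 , cond3) →
       let open Theorem.Sufficiency G conn r s a b c d a≤b c≤d cond1 cond2 cond3 in
       x , y , xBounds , yBounds , rEq , sEq })
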